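{- Let $\epsilon$ be the unique positive real root of the equation $\epsilon = \frac{1}{4}\left(1-\sqrt{\epsilon}\right)^3$ (so $\epsilon \approx 0.087$). Let $\mathscr{G}$ be a finite, simple, undirected, connected, regular graph on $n$ vertices with edge set $\mathscr{E}$. Let $3\mathscr{E}$ denote the set of unordered pairs $\{v_1,v_2\}$ of distinct vertices of $\mathscr{G}$ that are joined by a path in $\mathscr{G}$ of length at most $3$. Then $$|3\mathscr{E}| \geq \min\left\{ \binom{n}{2},\ (1+\epsilon)|\mathscr{E}| \right\}.$$ In particular, there is a universal constant $\epsilon>0$ with this property for all connected regular graphs.
   Context: Graphs are undirected and loopless. A graph is regular if all its vertices have the same degree. For a positive integer $h$, the $h$-fold sumgraph $h\mathscr{G}$ of $\mathscr{G}$ is the graph on the same vertex set in which two distinct vertices are adjacent iff they are joined by a path of length at most $h$ in $\mathscr{G}$; its edge set is denoted $h\mathscr{E}$. -}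

module Defs where

open import Data.Nat using (ℕ; zero; suc; _+_; _*_; _<ᵇ_)
open import Data.Fin using (Fin; toℕ)
open import Data.Fin.Properties using () renaming (_≟_ to _≟ᶠ_)
open import Data.Bool using (Bool; true; false; _∧_; _∨_; not; if_then_else_; T)
open import Data.List using (List; map)
open import Data.Nat.ListAction using (sum)
open import Data.Bool.ListAction using (any)
open import Data.List using () renaming (allFin to finList)
open import Data.Product using (∃; Σ)
open import Data.Integer as ℤ using (ℤ; +_)
open import Relation.Nullary.Decidable using (⌊_⌋)
open import Relation.Binary.PropositionalEquality using (_≡_)

record Graph (n : ℕ) : Set where
  field
    adj    : Fin n → Fin n → Bool
    sym    : ∀ u v → adj u v ≡ adj v u
    irrefl : ∀ v → adj v v ≡ false
open Graph public

countV : {n : ℕ} → (Fin n → Bool) → ℕ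
countV {n} p = sum (map (λ w → if p w then 1 else 0) (finList n))

degree : {n : ℕ} → Graph n → Fin n → ℕ
degree G v = countV (adj G v)

Regular : {n : ℕ} → Graph n → Set
Regular G = ∃ λ d → ∀ v → degree G v ≡ d

walkLE : {n : ℕ} → Graph n → ℕ → Fin n → Fin n → Bool
walkLE G zero    u v = ⌊ u ≟ᶠ v ⌋
walkLE {n} G (suc h) u v =
  walkLE G h u v ∨ any (λ w → walkLE G h u w ∧ adj G w v) (finList n)

Connected : {n : ℕ} → Graph n → Set
Connected G = ∀ u v → ∃ λ h → T (walkLE G h u v)

-- adjacency of the h-fold sumgraph hG: distinct vertices joined by a
-- walk (equivalently a path) of length at most h
sumAdj : {n : ℕ} → Graph n → ℕ → Fin n → Fin n → Bool
sumAdj G h u v = not ⌊ u ≟ᶠ v ⌋ ∧ walkLE G h u v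

countPairs : {n : ℕ} → (Fin n → Fin n → Bool) → ℕ
countPairs {n} r =
  sum (map (λ u → countV (λ v → (toℕ u <ᵇ toℕ v) ∧ r u v)) (finList n))

numEdges : {n : ℕ} → Graph n → ℕ
numEdges G = countPairs (adj G)

numSumEdges : {n : ℕ} → Graph n → ℕ → ℕ
numSumEdges G h = countPairs (sumAdj G h)

-- AtLeastOnePlusEps t e  expresses  t ≥ (1 + ε) e  for natural numbers t, e,
-- where ε is the unique positive real root of ε = (1 - √ε)³ / 4.
-- Derivation: with s = √ε ∈ (0,1) we have 4s² = (1-s)³, and
-- f(s) = 4s² - (1-s)³ is strictly increasing on [0,∞).  For x ≥ 0,
-- x ≥ ε ⟺ f(√x) ≥ 0 ⟺ √x (3 + x) ≥ 1 - x ⟺ x (3 + x)² ≥ (1 - x)²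
-- (for x < 1 both sides of the middle inequality are ≥ 0; for x ≥ 1 all hold).
-- With x = (t - e)/e and clearing the denominator e³ this becomes
--   (t - e)(t + 2e)² ≥ e (2e - t)²   (in ℤ),
-- which is also correct when t < e (both sides false) and when e = 0.
AtLeastOnePlusEps : ℕ → ℕ → Set
AtLeastOnePlusEps t e =
  (+ e) ℤ.* ((+ (2 * e)) ℤ.- (+ t)) ℤ.* ((+ (2 * e)) ℤ.- (+ t))
    ℤ.≤ ((+ t) ℤ.- (+ e)) ℤ.* (+ (t + 2 * e)) ℤ.* (+ (t + 2 * e))

{-# OPTIONS --safe #-}

-- Let d be the degree and N(v) the size of the ball of radius 3 around v, so that
-- ∑ N = n + 2|3E| and n d = 2|E|.  If 3G is complete, |3E| = n C 2.  Otherwise two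
-- vertices are at distance > 3, their closed neighbourhoods are disjoint, and n ≥ 2(d+1).
-- Call x rich when N(x) ≥ 2(d+1).  Every v satisfies N(v) + #(rich neighbours of v) ≥ 2(d+1):
-- if v is not rich, connectivity gives an edge pq leaving the ball of radius 2 around v;
-- the closed neighbourhoods of v and p lie in the 3-ball of v, and every common vertex x
-- is a rich neighbour of v, since the 3-ball of x contains the disjoint closed
-- neighbourhoods of v and q.  A rich x has only d neighbours and every N(x) ≥ d + 1, so
-- summing over all vertices gives 3 n d ≤ 4|3E|, i.e. |3E| ≥ (3/2)|E|, and 3/2 ≥ 1 + ε.

module Submission where

open import Defs renaming (sym to adj-sym)
open import Data.Nat using (ℕ; zero; suc; _+_; _*_; _≤_; _<ᵇ_; _≤ᵇ_; z≤n)
import Data.Nat.Properties as ℕP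
open import Data.Nat.Combinatorics using (_C_; nC1≡n; nCk+nC[k+1]≡[n+1]C[k+1])
open import Data.Nat.Tactic.RingSolver using () renaming (solve-∀ to ℕ-solve-∀)
open import Data.Nat.ListAction using (sum)
open import Algebra.Properties.CommutativeMonoid.Sum ℕP.+-0-commutativeMonoid
  using (sum-syntax; sum-cong-≗; ∑-distrib-+; ∑-comm)
open import Data.Fin using (Fin; toℕ) renaming (zero to fzero; suc to fsuc)
open import Data.Fin.Properties using (_≟_; toℕ-injective; suc-injective; any?; ¬∀⟶∃¬)
open import Data.Bool using (Bool; true; false; _∧_; _∨_; not; if_then_else_; T)
open import Data.Bool.Properties using (T-∧; T-∨; T-≡; ∧-zeroʳ; T?)
open import Data.List using (map; tabulate; allFin)
open import Data.List.Relation.Unary.Any using (satisfied)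
open import Data.List.Relation.Unary.Any.Properties using (any⁺; any⁻)
open import Data.List.Membership.Propositional using (lose)
open import Data.List.Membership.Propositional.Properties using (∈-allFin)
open import Data.Product using (∃; ∃₂; _×_; _,_; proj₁; proj₂)
open import Data.Sum using (_⊎_; inj₁; inj₂; [_,_]′)
open import Data.Empty using (⊥-elim)
open import Data.Unit using (tt)
open import Function using (_∘_; Equivalence)
open Equivalence using (to; from)
open import Relation.Nullary using (¬_; yes; no; contradiction)
open import Relation.Nullary.Decidable
  using (⌊_⌋; toWitness; fromWitness; fromWitnessFalse; toWitnessFalse; ¬?; decidable-stable)
open import Relation.Binary.PropositionalEquality

sum-map-tabulate : ∀ {A : Set} {n} (f : A → ℕ) (g : Fin n → A) →
                   sum (map f (tabulate g)) ≡ ∑[ i < n ] f (g i)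
sum-map-tabulate {n = zero}  f g = refl
sum-map-tabulate {n = suc n} f g = cong (f (g fzero) +_) (sum-map-tabulate f (g ∘ fsuc))

∑-const : ∀ n c → ∑[ i < n ] c ≡ n * c
∑-const zero    c = refl
∑-const (suc n) c = cong (c +_) (∑-const n c)

∑-zero : ∀ {n} {f : Fin n → ℕ} → (∀ i → f i ≡ 0) → ∑[ i < n ] f i ≡ 0
∑-zero {zero}  _   = refl
∑-zero {suc n} f≡0 = cong₂ _+_ (f≡0 fzero) (∑-zero (f≡0 ∘ fsuc))

∑-delta : ∀ {n} (f : Fin n → ℕ) v → (∀ i → i ≢ v → f i ≡ 0) → ∑[ i < n ] f i ≡ f v
∑-delta {suc n} f fzero    off =
  trans (cong (f fzero +_) (∑-zero (λ i → off (fsuc i) λ ()))) (ℕP.+-identityʳ (f fzero))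
∑-delta {suc n} f (fsuc v) off =
  cong₂ _+_ (off fzero λ ()) (∑-delta (f ∘ fsuc) v (λ i i≢v → off (fsuc i) (i≢v ∘ suc-injective)))

∑-mono-≤ : ∀ {n} {f g : Fin n → ℕ} → (∀ i → f i ≤ g i) → ∑[ i < n ] f i ≤ ∑[ i < n ] g i
∑-mono-≤ {zero}  _   = z≤n
∑-mono-≤ {suc n} f≤g = ℕP.+-mono-≤ (f≤g fzero) (∑-mono-≤ (f≤g ∘ fsuc))

T-injective : ∀ {a b} → (T a → T b) → (T b → T a) → a ≡ b
T-injective {false} {false} _   _   = refl
T-injective {false} {true}  _   b⇒a = ⊥-elim (b⇒a tt)
T-injective {true}  {false} a⇒b _   = ⊥-elim (a⇒b tt)
T-injective {true}  {true}  _   _   = refl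

∧-congʳ : ∀ {a b} c → (T c → a ≡ b) → a ∧ c ≡ b ∧ c
∧-congʳ {a} {b} false _   = trans (∧-zeroʳ a) (sym (∧-zeroʳ b))
∧-congʳ         true  a≡b = cong (_∧ true) (a≡b tt)

not-<ᵇ : ∀ {m n} → m ≢ n → not (m <ᵇ n) ≡ (n <ᵇ m)
not-<ᵇ {zero}  {zero}  m≢n = contradiction refl m≢n
not-<ᵇ {zero}  {suc n} _   = refl
not-<ᵇ {suc m} {zero}  _   = refl
not-<ᵇ {suc m} {suc n} m≢n = not-<ᵇ (m≢n ∘ cong suc)

𝟙 : Bool → ℕ
𝟙 b = if b then 1 else 0

𝟙-mono : ∀ {a b} → (T a → T b) → 𝟙 a ≤ 𝟙 b
𝟙-mono {false}        _   = z≤n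
𝟙-mono {true} {true}  _   = ℕP.≤-refl
𝟙-mono {true} {false} a⇒b = ⊥-elim (a⇒b tt)

𝟙-false : ∀ {b} → ¬ T b → 𝟙 b ≡ 0
𝟙-false {false} _  = refl
𝟙-false {true}  ¬⊤ = contradiction tt ¬⊤

𝟙-∨+𝟙-∧ : ∀ a b → 𝟙 (a ∨ b) + 𝟙 (a ∧ b) ≡ 𝟙 a + 𝟙 b
𝟙-∨+𝟙-∧ true  true  = refl
𝟙-∨+𝟙-∧ true  false = refl
𝟙-∨+𝟙-∧ false true  = refl
𝟙-∨+𝟙-∧ false false = refl

𝟙-split : ∀ a b → 𝟙 b ≡ 𝟙 (a ∧ b) + 𝟙 (not a ∧ b)
𝟙-split true  b = sym (ℕP.+-identityʳ (𝟙 b))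
𝟙-split false b = refl

module _ {n : ℕ} where

  count : (Fin n → Bool) → ℕ
  count p = ∑[ w < n ] 𝟙 (p w)

  countV≡count : ∀ (p : Fin n → Bool) → countV p ≡ count p
  countV≡count p = sum-map-tabulate (𝟙 ∘ p) (λ w → w)

  count-mono : ∀ {p q} → (∀ w → T (p w) → T (q w)) → count p ≤ count q
  count-mono p⇒q = ∑-mono-≤ (λ w → 𝟙-mono (p⇒q w))

  count-cong : ∀ {p q} → (∀ w → T (p w) → T (q w)) → (∀ w → T (q w) → T (p w)) → count p ≡ count q
  count-cong p⇒q q⇒p = sum-cong-≗ (λ w → cong 𝟙 (T-injective (p⇒q w) (q⇒p w)))

  count-∨+count-∧ : ∀ (p q : Fin n → Bool) →
                    count (λ w → p w ∨ q w) + count (λ w → p w ∧ q w) ≡ count p + count q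
  count-∨+count-∧ p q = begin
    count (λ w → p w ∨ q w) + count (λ w → p w ∧ q w)
      ≡⟨ ∑-distrib-+ (λ w → 𝟙 (p w ∨ q w)) (λ w → 𝟙 (p w ∧ q w)) ⟨
    ∑[ w < n ] (𝟙 (p w ∨ q w) + 𝟙 (p w ∧ q w))
      ≡⟨ sum-cong-≗ (λ w → 𝟙-∨+𝟙-∧ (p w) (q w)) ⟩
    ∑[ w < n ] (𝟙 (p w) + 𝟙 (q w))
      ≡⟨ ∑-distrib-+ (𝟙 ∘ p) (𝟙 ∘ q) ⟩
    count p + count q ∎
    where open ≡-Reasoning

  count-split : ∀ (q p : Fin n → Bool) →
                count p ≡ count (λ w → q w ∧ p w) + count (λ w → not (q w) ∧ p w)
  count-split q p = trans (sum-cong-≗ (λ w → 𝟙-split (q w) (p w)))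
                          (∑-distrib-+ (λ w → 𝟙 (q w ∧ p w)) (λ w → 𝟙 (not (q w) ∧ p w)))

  count-none : ∀ {p} → (∀ w → ¬ T (p w)) → count p ≡ 0
  count-none none = ∑-zero (λ w → 𝟙-false (none w))

  count-all : ∀ {p} → (∀ w → T (p w)) → count p ≡ n
  count-all all = begin
    count _         ≡⟨ count-cong (λ _ _ → tt) (λ w _ → all w) ⟩
    ∑[ w < n ] 1    ≡⟨ ∑-const n 1 ⟩
    n * 1           ≡⟨ ℕP.*-identityʳ n ⟩
    n               ∎
    where open ≡-Reasoning

  count-punctured : ∀ v (p : Fin n → Bool) → count p ≡ 𝟙 (p v) + count (λ w → not ⌊ v ≟ w ⌋ ∧ p w)
  count-punctured v p = trans (count-split (λ w → ⌊ v ≟ w ⌋) p) (cong₂ _+_ at-v refl)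
    where
    off-v : ∀ w → w ≢ v → 𝟙 (⌊ v ≟ w ⌋ ∧ p w) ≡ 0
    off-v w w≢v = 𝟙-false (λ t → w≢v (sym (toWitness (proj₁ (to (T-∧ {⌊ v ≟ w ⌋}) t)))))
    at-v : count (λ w → ⌊ v ≟ w ⌋ ∧ p w) ≡ 𝟙 (p v)
    at-v = trans (∑-delta (λ w → 𝟙 (⌊ v ≟ w ⌋ ∧ p w)) v off-v)
                 (cong (λ b → 𝟙 (b ∧ p v)) (T-injective (λ _ → tt) (λ _ → fromWitness refl)))

  countPairs≡∑ : ∀ (r : Fin n → Fin n → Bool) →
                 countPairs r ≡ ∑[ u < n ] count (λ v → (toℕ u <ᵇ toℕ v) ∧ r u v)
  countPairs≡∑ r = trans (sum-map-tabulate (λ u → countV (above u)) (λ u → u))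
                         (sum-cong-≗ (λ u → countV≡count (above u)))
    where
    above : Fin n → Fin n → Bool
    above u v = (toℕ u <ᵇ toℕ v) ∧ r u v

  handshake : ∀ (r : Fin n → Fin n → Bool) → (∀ u v → r u v ≡ r v u) → (∀ v → r v v ≡ false) →
              ∑[ u < n ] count (r u) ≡ 2 * countPairs r
  handshake r r-sym r-irrefl = begin
    ∑[ u < n ] count (r u)
      ≡⟨ sum-cong-≗ (λ u → count-split (λ v → toℕ u <ᵇ toℕ v) (r u)) ⟩
    ∑[ u < n ] (above u + count (λ v → not (toℕ u <ᵇ toℕ v) ∧ r u v))
      ≡⟨ ∑-distrib-+ above (λ u → count (λ v → not (toℕ u <ᵇ toℕ v) ∧ r u v)) ⟩
    P + ∑[ u < n ] ∑[ v < n ] 𝟙 (not (toℕ u <ᵇ toℕ v) ∧ r u v)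
      ≡⟨ cong (P +_) (sum-cong-≗ (λ u → sum-cong-≗ (λ v → cong 𝟙 (mirror u v)))) ⟩
    P + ∑[ u < n ] ∑[ v < n ] 𝟙 ((toℕ v <ᵇ toℕ u) ∧ r v u)
      ≡⟨ cong (P +_) (∑-comm (λ u v → 𝟙 ((toℕ v <ᵇ toℕ u) ∧ r v u))) ⟩
    P + P
      ≡⟨ cong (P +_) (ℕP.+-identityʳ P) ⟨
    2 * P
      ≡⟨ cong (2 *_) (countPairs≡∑ r) ⟨
    2 * countPairs r ∎
    where
    open ≡-Reasoning
    above : Fin n → ℕ
    above u = count (λ v → (toℕ u <ᵇ toℕ v) ∧ r u v)
    P : ℕ
    P = ∑[ u < n ] above u
    mirror : ∀ u v → not (toℕ u <ᵇ toℕ v) ∧ r u v ≡ (toℕ v <ᵇ toℕ u) ∧ r v u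
    mirror u v = trans (∧-congʳ (r u v) (λ ruv → not-<ᵇ (λ u≡v → subst T (u≡v⇒r≡false u≡v) ruv)))
                     (cong (_ ∧_) (r-sym u v))
      where
      u≡v⇒r≡false : toℕ u ≡ toℕ v → r u v ≡ false
      u≡v⇒r≡false eq = trans (cong (λ w → r w v) (toℕ-injective eq)) (r-irrefl v)

C2-identity : ∀ n → n + 2 * (n C 2) ≡ n * n
C2-identity zero    = refl
C2-identity (suc n) = begin
  suc n + 2 * (suc n C 2)          ≡⟨ cong (λ c → suc n + 2 * c) Pascal ⟩
  suc n + 2 * (n + n C 2)          ≡⟨ rearrange n (n C 2) ⟩
  (n + 2 * (n C 2)) + (n + suc n)  ≡⟨ cong (_+ (n + suc n)) (C2-identity n) ⟩
  n * n + (n + suc n)              ≡⟨ square n ⟩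
  suc n * suc n                    ∎
  where
  open ≡-Reasoning
  Pascal : suc n C 2 ≡ n + n C 2
  Pascal = trans (sym (nCk+nC[k+1]≡[n+1]C[k+1] n 1)) (cong (_+ n C 2) (nC1≡n n))
  rearrange : ∀ n c → suc n + 2 * (n + c) ≡ (n + 2 * c) + (n + suc n)
  rearrange = ℕ-solve-∀
  square : ∀ n → n * n + (n + suc n) ≡ suc n * suc n
  square = ℕ-solve-∀

three-halves-arith : ∀ {n d S H t e} →
  n * (suc d + suc d) ≤ S + H → H + n * suc d ≤ S → S ≡ n + 2 * t → n * d ≡ 2 * e → 3 * e ≤ 2 * t
three-halves-arith {n} {d} {S} {H} {t} {e} local incid S≡ nd≡ =
  ℕP.*-cancelˡ-≤ 2 (ℕP.+-cancelʳ-≤ (3 * n) _ _ (begin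
    2 * (3 * e) + 3 * n              ≡⟨ swap e n ⟩
    3 * (2 * e) + 3 * n              ≡⟨ cong (λ m → 3 * m + 3 * n) nd≡ ⟨
    3 * (n * d) + 3 * n              ≡⟨ expand n d ⟩
    n * (suc d + suc d) + n * suc d  ≤⟨ ℕP.+-monoˡ-≤ (n * suc d) local ⟩
    S + H + n * suc d                ≡⟨ ℕP.+-assoc S H (n * suc d) ⟩
    S + (H + n * suc d)              ≤⟨ ℕP.+-monoʳ-≤ S incid ⟩
    S + S                            ≡⟨ cong (λ s → s + s) S≡ ⟩
    (n + 2 * t) + (n + 2 * t)        ≡⟨ collect n t ⟩
    2 * (2 * t) + 2 * n              ≤⟨ ℕP.+-monoʳ-≤ (2 * (2 * t)) (ℕP.*-monoˡ-≤ n (ℕP.n≤1+n 2)) ⟩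
    2 * (2 * t) + 3 * n              ∎))
  where
  open ℕP.≤-Reasoning
  swap : ∀ e n → 2 * (3 * e) + 3 * n ≡ 3 * (2 * e) + 3 * n
  swap = ℕ-solve-∀
  expand : ∀ n d → 3 * (n * d) + 3 * n ≡ n * (suc d + suc d) + n * suc d
  expand = ℕ-solve-∀
  collect : ∀ n t → (n + 2 * t) + (n + 2 * t) ≡ 2 * (2 * t) + 2 * n
  collect = ℕ-solve-∀

module Walks {n : ℕ} (G : Graph n) where

  -- Opaque, so that unification can read h, u and v off T (ball h u v).
  opaque
    ball : ℕ → Fin n → Fin n → Bool
    ball = walkLE G

    ball≡walkLE : ∀ h u v → ball h u v ≡ walkLE G h u v
    ball≡walkLE h u v = refl

    ball-0-refl : ∀ v → T (ball 0 v v)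
    ball-0-refl v = fromWitness refl

    ball-0⇒≡ : ∀ {u v} → T (ball 0 u v) → u ≡ v
    ball-0⇒≡ uv = toWitness uv

    ball-suc : ∀ {h u v} → T (ball h u v) → T (ball (suc h) u v)
    ball-suc uv = from T-∨ (inj₁ uv)

    ball-step : ∀ {h u w v} → T (ball h u w) → T (adj G w v) → T (ball (suc h) u v)
    ball-step {h} {u} {w} {v} uw wv =
      from T-∨ (inj₂ (any⁺ (λ z → ball h u z ∧ adj G z v) (lose (∈-allFin w) (from T-∧ (uw , wv)))))

    ball-suc-inv : ∀ {h u v} → T (ball (suc h) u v) →
                   T (ball h u v) ⊎ ∃ λ w → T (ball h u w) × T (adj G w v)
    ball-suc-inv {h} {u} {v} uv with to T-∨ uv
    ... | inj₁ uv′  = inj₁ uv′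
    ... | inj₂ step with satisfied (any⁻ (λ w → ball h u w ∧ adj G w v) (allFin n) step)
    ...   | w , uwv = inj₂ (w , to T-∧ uwv)

  ball-weaken : ∀ m {h u v} → T (ball h u v) → T (ball (m + h) u v)
  ball-weaken zero    uv = uv
  ball-weaken (suc m) uv = ball-suc (ball-weaken m uv)

  ball-centre : ∀ h v → T (ball h v v)
  ball-centre h v = subst (λ j → T (ball j v v)) (ℕP.+-identityʳ h) (ball-weaken h (ball-0-refl v))

  adj⇒ball-1 : ∀ {u v} → T (adj G u v) → T (ball 1 u v)
  adj⇒ball-1 = ball-step (ball-0-refl _)

  ball-1⇒ : ∀ {u v} → T (ball 1 u v) → u ≡ v ⊎ T (adj G u v)
  ball-1⇒ uv with ball-suc-inv uv
  ... | inj₁ u≡v              = inj₁ (ball-0⇒≡ u≡v)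
  ... | inj₂ (w , u≡w , wv) with ball-0⇒≡ u≡w
  ...   | refl = inj₂ wv

  ball-trans : ∀ {h k u w v} → T (ball h u w) → T (ball k w v) → T (ball (h + k) u v)
  ball-trans {h} {zero}  {u} uw wv with ball-0⇒≡ wv
  ... | refl = subst (λ j → T (ball j u _)) (sym (ℕP.+-identityʳ h)) uw
  ball-trans {h} {suc k} {u} {v = v} uw wv =
    subst (λ j → T (ball j u v)) (sym (ℕP.+-suc h k))
      ([ (λ wv′ → ball-suc (ball-trans uw wv′))
       , (λ { (z , wz , zv) → ball-step (ball-trans uw wz) zv })
       ]′ (ball-suc-inv wv))

  ball-sym : ∀ {h u v} → T (ball h u v) → T (ball h v u)
  ball-sym {zero}          uv with ball-0⇒≡ uv
  ... | refl = uv
  ball-sym {suc h} {u} {v} uv with ball-suc-inv uv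
  ... | inj₁ uv′             = ball-suc (ball-sym uv′)
  ... | inj₂ (w , uw , wv)   =
    ball-trans {1} {h} (adj⇒ball-1 (subst T (adj-sym G w v) wv)) (ball-sym uw)

  adj⇒≢ : ∀ {u v} → T (adj G u v) → u ≢ v
  adj⇒≢ {u} uv refl = subst T (irrefl G u) uv

  exit-edge : ∀ (S : Fin n → Bool) {h u v} → T (S u) → ¬ T (S v) → T (ball h u v) →
              ∃₂ λ p q → T (S p) × T (adj G p q) × ¬ T (S q)
  exit-edge S {zero} Su ¬Sv uv with ball-0⇒≡ uv
  ... | refl = contradiction Su ¬Sv
  exit-edge S {suc h} Su ¬Sv uv with ball-suc-inv uv
  ... | inj₁ uv′ = exit-edge S Su ¬Sv uv′
  ... | inj₂ (w , uw , wv) with T? (S w)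
  ...   | yes Sw  = w , _ , Sw , wv , ¬Sv
  ...   | no ¬Sw  = exit-edge S Su ¬Sw uw

  leaving-edge : Connected G → ∀ {h v z} → ¬ T (ball h v z) →
                 ∃₂ λ p q → T (ball h v p) × T (adj G p q) × ¬ T (ball h v q)
  leaving-edge connected {h} {v} {z} far with connected v z
  ... | k , walk = exit-edge (ball h v) (ball-centre h v) far (subst T (sym (ball≡walkLE k v z)) walk)

  full-or-far : ∀ h → (∀ u v → T (ball h u v)) ⊎ ∃₂ λ u v → ¬ T (ball h u v)
  full-or-far h with any? (λ u → any? (λ v → ¬? (T? (ball h u v))))
  ... | yes (u , v , far) = inj₂ (u , v , far)
  ... | no none = inj₁ (λ u v → decidable-stable (T? (ball h u v)) (λ far → none (u , v , far)))

  sumAdj-sym : ∀ h u v → sumAdj G h u v ≡ sumAdj G h v u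
  sumAdj-sym h u v with u ≟ v | v ≟ u
  ... | yes _   | yes _   = refl
  ... | yes u≡v | no v≢u  = contradiction (sym u≡v) v≢u
  ... | no u≢v  | yes v≡u = contradiction (sym v≡u) u≢v
  ... | no _    | no _    = begin
    walkLE G h u v ≡⟨ ball≡walkLE h u v ⟨
    ball h u v     ≡⟨ T-injective ball-sym ball-sym ⟩
    ball h v u     ≡⟨ ball≡walkLE h v u ⟩
    walkLE G h v u ∎
    where open ≡-Reasoning

  sumAdj-irrefl : ∀ h v → sumAdj G h v v ≡ false
  sumAdj-irrefl h v with v ≟ v
  ... | yes _  = refl
  ... | no v≢v = contradiction refl v≢v

  count-ball : ∀ h v → count (ball h v) ≡ suc (count (sumAdj G h v))
  count-ball h v = trans (count-punctured v (ball h v))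
    (cong₂ _+_ (cong 𝟙 (to T-≡ (ball-centre h v)))
               (sum-cong-≗ (λ w → cong (λ b → 𝟙 (not ⌊ v ≟ w ⌋ ∧ b)) (ball≡walkLE h v w))))

  count-sumAdj-1 : ∀ v → count (sumAdj G 1 v) ≡ degree G v
  count-sumAdj-1 v = trans (count-cong sumAdj⇒adj adj⇒sumAdj) (sym (countV≡count (adj G v)))
    where
    sumAdj⇒adj : ∀ w → T (sumAdj G 1 v w) → T (adj G v w)
    sumAdj⇒adj w t with to (T-∧ {not ⌊ v ≟ w ⌋}) t
    ... | v≢w , vw with ball-1⇒ (subst T (sym (ball≡walkLE 1 v w)) vw)
    ...   | inj₁ v≡w = contradiction v≡w (toWitnessFalse v≢w)
    ...   | inj₂ a   = a
    adj⇒sumAdj : ∀ w → T (adj G v w) → T (sumAdj G 1 v w)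
    adj⇒sumAdj w a = from T-∧ (fromWitnessFalse (adj⇒≢ a) , subst T (ball≡walkLE 1 v w) (adj⇒ball-1 a))

  ∑-count-ball : ∀ h → ∑[ v < n ] count (ball h v) ≡ n + 2 * numSumEdges G h
  ∑-count-ball h = begin
    ∑[ v < n ] count (ball h v)
      ≡⟨ sum-cong-≗ (count-ball h) ⟩
    ∑[ v < n ] (1 + count (sumAdj G h v))
      ≡⟨ ∑-distrib-+ (λ _ → 1) (λ v → count (sumAdj G h v)) ⟩
    ∑[ v < n ] 1 + ∑[ v < n ] count (sumAdj G h v)
      ≡⟨ cong₂ _+_ (trans (∑-const n 1) (ℕP.*-identityʳ n))
                   (handshake (sumAdj G h) (sumAdj-sym h) (sumAdj-irrefl h)) ⟩
    n + 2 * numSumEdges G h ∎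
    where open ≡-Reasoning

  numSumEdges-complete : ∀ h → (∀ u v → T (ball h u v)) → numSumEdges G h ≡ n C 2
  numSumEdges-complete h full = ℕP.*-cancelˡ-≡ _ _ 2 (ℕP.+-cancelˡ-≡ n _ _ (begin
    n + 2 * numSumEdges G h      ≡⟨ ∑-count-ball h ⟨
    ∑[ v < n ] count (ball h v)  ≡⟨ sum-cong-≗ (λ v → count-all (full v)) ⟩
    ∑[ v < n ] n                 ≡⟨ ∑-const n n ⟩
    n * n                        ≡⟨ C2-identity n ⟨
    n + 2 * (n C 2)              ∎))
    where open ≡-Reasoning

module RegularGraph {n : ℕ} (G : Graph n) (d : ℕ) (regular : ∀ v → degree G v ≡ d) where
  open Walks G

  count-adj : ∀ v → count (adj G v) ≡ d
  count-adj v = trans (sym (countV≡count (adj G v))) (regular v)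

  count-ball-1 : ∀ v → count (ball 1 v) ≡ suc d
  count-ball-1 v = trans (count-ball 1 v) (cong suc (trans (count-sumAdj-1 v) (regular v)))

  nbhd-pair : ∀ {u w} (p q : Fin n → Bool) →
              (∀ x → T (ball 1 u x ∨ ball 1 w x) → T (p x)) →
              (∀ x → T (ball 1 u x ∧ ball 1 w x) → T (q x)) →
              suc d + suc d ≤ count p + count q
  nbhd-pair {u} {w} p q ∪⊆p ∩⊆q = begin
    suc d + suc d
      ≡⟨ cong₂ _+_ (count-ball-1 u) (count-ball-1 w) ⟨
    count (ball 1 u) + count (ball 1 w)
      ≡⟨ count-∨+count-∧ (ball 1 u) (ball 1 w) ⟨
    count (λ x → ball 1 u x ∨ ball 1 w x) + count (λ x → ball 1 u x ∧ ball 1 w x)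
      ≤⟨ ℕP.+-mono-≤ (count-mono ∪⊆p) (count-mono ∩⊆q) ⟩
    count p + count q ∎
    where open ℕP.≤-Reasoning

  far-nbhds : ∀ {u w} (p : Fin n → Bool) → ¬ T (ball 2 u w) →
              (∀ x → T (ball 1 u x ∨ ball 1 w x) → T (p x)) → suc d + suc d ≤ count p
  far-nbhds {u} {w} p far ∪⊆p = subst (suc d + suc d ≤_) (ℕP.+-identityʳ (count p))
    (subst (λ c → suc d + suc d ≤ count p + c) (count-none {n} {λ _ → false} (λ _ ()))
      (nbhd-pair p (λ _ → false) ∪⊆p disjoint))
    where
    disjoint : ∀ x → T (ball 1 u x ∧ ball 1 w x) → T false
    disjoint x t with to (T-∧ {ball 1 u x}) t
    ... | ux , wx = far (ball-trans {1} {1} ux (ball-sym wx))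

  rich : Fin n → Bool
  rich x = suc d + suc d ≤ᵇ count (ball 3 x)

  rich-between : ∀ {u w x} → T (ball 1 u x) → T (ball 2 w x) → ¬ T (ball 2 u w) → T (rich x)
  rich-between {u} {w} {x} ux wx far = ℕP.≤⇒≤ᵇ (far-nbhds (ball 3 x) far ∪⊆ball-3)
    where
    ∪⊆ball-3 : ∀ y → T (ball 1 u y ∨ ball 1 w y) → T (ball 3 x y)
    ∪⊆ball-3 y t with to (T-∨ {ball 1 u y}) t
    ... | inj₁ uy = ball-weaken 1 (ball-trans {1} {1} (ball-sym ux) uy)
    ... | inj₂ wy = ball-trans {2} {1} (ball-sym wx) wy

  rich-nbrs : Fin n → ℕ
  rich-nbrs v = count (λ x → adj G v x ∧ rich x)

  poor⇒outside-ball-2 : ∀ {v} → ¬ T (rich v) → suc d + suc d ≤ n → ∃ λ z → ¬ T (ball 2 v z)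
  poor⇒outside-ball-2 {v} ¬rich-v big = ¬∀⟶∃¬ n _ (λ z → T? (ball 2 v z)) λ all →
    ¬rich-v (ℕP.≤⇒≤ᵇ (begin
      suc d + suc d     ≤⟨ big ⟩
      n                 ≡⟨ count-all all ⟨
      count (ball 2 v)  ≤⟨ count-mono (λ z → ball-weaken 1 {2} {v} {z}) ⟩
      count (ball 3 v)  ∎))
    where open ℕP.≤-Reasoning

  local-bound : Connected G → suc d + suc d ≤ n → ∀ v → suc d + suc d ≤ count (ball 3 v) + rich-nbrs v
  local-bound connected big v with T? (rich v)
  ... | yes rich-v =
    ℕP.≤-trans (ℕP.≤ᵇ⇒≤ (suc d + suc d) (count (ball 3 v)) rich-v) (ℕP.m≤m+n _ (rich-nbrs v))
  ... | no ¬rich-v with leaving-edge connected (proj₂ (poor⇒outside-ball-2 ¬rich-v big))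
  ...   | p , q , vp , pq , ¬vq = nbhd-pair (ball 3 v) (λ x → adj G v x ∧ rich x) ∪⊆ball-3 ∩⊆rich-nbrs
    where
    ∪⊆ball-3 : ∀ x → T (ball 1 v x ∨ ball 1 p x) → T (ball 3 v x)
    ∪⊆ball-3 x t with to (T-∨ {ball 1 v x}) t
    ... | inj₁ vx = ball-weaken 2 vx
    ... | inj₂ px = ball-trans {2} {1} vp px
    ∩⊆rich-nbrs : ∀ x → T (ball 1 v x ∧ ball 1 p x) → T (adj G v x ∧ rich x)
    ∩⊆rich-nbrs x t with to (T-∧ {ball 1 v x}) t
    ... | vx , px with rich-between vx (ball-trans {1} {1} (ball-sym (adj⇒ball-1 pq)) px) ¬vq | ball-1⇒ vx
    ...   | rich-x | inj₁ refl   = contradiction rich-x ¬rich-v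
    ...   | rich-x | inj₂ adj-vx = from T-∧ (adj-vx , rich-x)

  rich-incidences : ∀ x → count (λ v → adj G v x ∧ rich x) + suc d ≤ count (ball 3 x)
  rich-incidences x with T? (rich x)
  ... | yes rich-x = begin
    count (λ v → adj G v x ∧ rich x) + suc d
      ≤⟨ ℕP.+-monoˡ-≤ (suc d) (count-mono incident⇒adj) ⟩
    count (adj G x) + suc d
      ≡⟨ cong (_+ suc d) (count-adj x) ⟩
    d + suc d
      ≤⟨ ℕP.+-monoˡ-≤ (suc d) (ℕP.n≤1+n d) ⟩
    suc d + suc d
      ≤⟨ ℕP.≤ᵇ⇒≤ (suc d + suc d) (count (ball 3 x)) rich-x ⟩
    count (ball 3 x) ∎
    where
    open ℕP.≤-Reasoning
    incident⇒adj : ∀ v → T (adj G v x ∧ rich x) → T (adj G x v)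
    incident⇒adj v t = subst T (adj-sym G v x) (proj₁ (to (T-∧ {adj G v x}) t))
  ... | no ¬rich-x = begin
    count (λ v → adj G v x ∧ rich x) + suc d
      ≡⟨ cong (_+ suc d) (count-none (λ v t → ¬rich-x (proj₂ (to (T-∧ {adj G v x}) t)))) ⟩
    suc d
      ≡⟨ count-ball-1 x ⟨
    count (ball 1 x)
      ≤⟨ count-mono (λ w → ball-weaken 2 {1} {x} {w}) ⟩
    count (ball 3 x) ∎
    where open ℕP.≤-Reasoning

  ∑-local-bound : Connected G → suc d + suc d ≤ n →
                  n * (suc d + suc d) ≤ ∑[ v < n ] count (ball 3 v) + ∑[ v < n ] rich-nbrs v
  ∑-local-bound connected big = begin
    n * (suc d + suc d)                                      ≡⟨ ∑-const n (suc d + suc d) ⟨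
    ∑[ v < n ] (suc d + suc d)                               ≤⟨ ∑-mono-≤ (local-bound connected big) ⟩
    ∑[ v < n ] (count (ball 3 v) + rich-nbrs v)              ≡⟨ ∑-distrib-+ (count ∘ ball 3) rich-nbrs ⟩
    ∑[ v < n ] count (ball 3 v) + ∑[ v < n ] rich-nbrs v     ∎
    where open ℕP.≤-Reasoning

  ∑-rich-incidences : ∑[ v < n ] rich-nbrs v + n * suc d ≤ ∑[ x < n ] count (ball 3 x)
  ∑-rich-incidences = begin
    ∑[ v < n ] rich-nbrs v + n * suc d
      ≡⟨ cong₂ _+_ (∑-comm (λ v x → 𝟙 (adj G v x ∧ rich x))) (sym (∑-const n (suc d))) ⟩
    ∑[ x < n ] count (λ v → adj G v x ∧ rich x) + ∑[ x < n ] suc d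
      ≡⟨ ∑-distrib-+ (λ x → count (λ v → adj G v x ∧ rich x)) (λ _ → suc d) ⟨
    ∑[ x < n ] (count (λ v → adj G v x ∧ rich x) + suc d)
      ≤⟨ ∑-mono-≤ rich-incidences ⟩
    ∑[ x < n ] count (ball 3 x) ∎
    where open ℕP.≤-Reasoning

  twice-numEdges : n * d ≡ 2 * numEdges G
  twice-numEdges = begin
    n * d                       ≡⟨ ∑-const n d ⟨
    ∑[ v < n ] d                ≡⟨ sum-cong-≗ count-adj ⟨
    ∑[ v < n ] count (adj G v)  ≡⟨ handshake (adj G) (adj-sym G) (irrefl G) ⟩
    2 * numEdges G              ∎
    where open ≡-Reasoning

  far⇒two-nbhds≤n : ∀ {u w} → ¬ T (ball 2 u w) → suc d + suc d ≤ n
  far⇒two-nbhds≤n far =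
    subst (suc d + suc d ≤_) (count-all {n} {λ _ → true} (λ _ → tt))
          (far-nbhds (λ _ → true) far (λ _ _ → tt))

  three-halves : Connected G → ∀ {u w} → ¬ T (ball 2 u w) → 3 * numEdges G ≤ 2 * numSumEdges G 3
  three-halves connected far =
    three-halves-arith {n} {d} {t = numSumEdges G 3} {e = numEdges G}
      (∑-local-bound connected (far⇒two-nbhds≤n far)) ∑-rich-incidences (∑-count-ball 3) twice-numEdges

module _ where
  open import Data.List using (_∷_; [])
  open import Data.Integer as ℤ using (ℤ; +_; +≤+)
  import Data.Integer.Properties as ℤP
  open import Data.Integer.Tactic.RingSolver using () renaming (solve to ℤ-solve)

  +-nonNeg : ∀ {i j} → + 0 ℤ.≤ i → + 0 ℤ.≤ j → + 0 ℤ.≤ i ℤ.+ j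
  +-nonNeg = ℤP.+-mono-≤

  *-nonNeg : ∀ {i j} → + 0 ℤ.≤ i → + 0 ℤ.≤ j → + 0 ℤ.≤ i ℤ.* j
  *-nonNeg {i} {j} 0≤i 0≤j = ℤP.*-monoʳ-≤-nonNeg j {{ℤ.nonNegative 0≤j}} 0≤i

  -- With D = 2T − 3E, i.e. T ≥ (3/2)E, eight times the difference of the two sides of
  -- AtLeastOnePlusEps is a polynomial in E and D with nonnegative coefficients.
  eightfold-gap : ∀ T E D → D ≡ + 2 ℤ.* T ℤ.- + 3 ℤ.* E →
    + 8 ℤ.* ((T ℤ.- E) ℤ.* (T ℤ.+ + 2 ℤ.* E) ℤ.* (T ℤ.+ + 2 ℤ.* E))
      ≡ + 8 ℤ.* (E ℤ.* (+ 2 ℤ.* E ℤ.- T) ℤ.* (+ 2 ℤ.* E ℤ.- T))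
        ℤ.+ (D ℤ.* D ℤ.* D ℤ.+ E ℤ.* (+ 13 ℤ.* D ℤ.* D ℤ.+ E ℤ.* (+ 67 ℤ.* D ℤ.+ + 47 ℤ.* E)))
  eightfold-gap T E _ refl = ℤ-solve (T ∷ E ∷ [])

  onePlusEps-ℤ : ∀ T E D → D ≡ + 2 ℤ.* T ℤ.- + 3 ℤ.* E → + 0 ℤ.≤ E → + 0 ℤ.≤ D →
    E ℤ.* (+ 2 ℤ.* E ℤ.- T) ℤ.* (+ 2 ℤ.* E ℤ.- T)
      ℤ.≤ (T ℤ.- E) ℤ.* (T ℤ.+ + 2 ℤ.* E) ℤ.* (T ℤ.+ + 2 ℤ.* E)
  onePlusEps-ℤ T E D D≡ 0≤E 0≤D = ℤP.*-cancelˡ-≤-pos _ _ (+ 8) (≤-by-gap (eightfold-gap T E D D≡)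
    (+-nonNeg (*-nonNeg (*-nonNeg 0≤D 0≤D) 0≤D)
              (*-nonNeg 0≤E (+-nonNeg (*-nonNeg (*-nonNeg (ℤP.nonNegative⁻¹ (+ 13)) 0≤D) 0≤D)
                                      (*-nonNeg 0≤E (+-nonNeg (*-nonNeg (ℤP.nonNegative⁻¹ (+ 67)) 0≤D)
                                                              (*-nonNeg (ℤP.nonNegative⁻¹ (+ 47)) 0≤E)))))))
    where
    ≤-by-gap : ∀ {i j k} → j ≡ i ℤ.+ k → + 0 ℤ.≤ k → i ℤ.≤ j
    ≤-by-gap {i} refl 0≤k = ℤP.i≤i+j i _ {{ℤ.nonNegative 0≤k}}

  threeHalves⇒onePlusEps : ∀ {t e} → 3 * e ≤ 2 * t → AtLeastOnePlusEps t e
  threeHalves⇒onePlusEps {t} {e} 3e≤2t =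
    subst₂ ℤ._≤_ (cong (λ z → + e ℤ.* (z ℤ.- + t) ℤ.* (z ℤ.- + t)) (sym 2e≡))
                 (cong (λ z → (+ t ℤ.- + e) ℤ.* z ℤ.* z) (sym t+2e≡))
                 (onePlusEps-ℤ (+ t) (+ e) _ refl (+≤+ z≤n) 0≤D)
    where
    2e≡ : + (2 * e) ≡ + 2 ℤ.* + e
    2e≡ = ℤP.pos-* 2 e
    t+2e≡ : + (t + 2 * e) ≡ + t ℤ.+ + 2 ℤ.* + e
    t+2e≡ = trans (ℤP.pos-+ t (2 * e)) (cong (λ z → + t ℤ.+ z) 2e≡)
    0≤D : + 0 ℤ.≤ + 2 ℤ.* + t ℤ.- + 3 ℤ.* + e
    0≤D = subst₂ (λ a b → + 0 ℤ.≤ a ℤ.- b) (ℤP.pos-* 2 t) (ℤP.pos-* 3 e) (ℤP.i≤j⇒0≤j-i (+≤+ 3e≤2t))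

theorem1p5 : {n : ℕ} (G : Graph n) → Connected G → Regular G →
    (n C 2 ≤ numSumEdges G 3) ⊎ AtLeastOnePlusEps (numSumEdges G 3) (numEdges G)
theorem1p5 G connected (d , regular) with Walks.full-or-far G 3
... | inj₁ full          = inj₁ (ℕP.≤-reflexive (sym (Walks.numSumEdges-complete G 3 full)))
... | inj₂ (_ , _ , far) = inj₂ (threeHalves⇒onePlusEps {numSumEdges G 3} {numEdges G}
                                 (RegularGraph.three-halves G d regular connected (far ∘ Walks.ball-weaken G 1)))
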